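{- Let $k \ge 2$ and $n \ge 1$ be integers, and let $d = \lceil 2\log_2(n) \rceil$. Every $k$-ary tree of height at most $\log_k(n)$ is contained as a subgraph in the uniformly stacked triangulation $S_d$.
   Context: The uniformly stacked triangulation $S_d$ of depth $d\in\mathbb{N}$ is defined inductively: $S_0$ is a triangle on three fixed non-collinear points $o_1,o_2,o_3$ in the plane; for $d>0$, $S_d$ is obtained from $S_{d-1}$ by placing, in the interior of each bounded triangular face of $S_{d-1}$, a new vertex joined to the three vertices of that face. A $k$-ary tree of height $h$ is a rooted tree in which every vertex has exactly $k$ children, except the vertices on level $h$, which are all leaves (the root is on level $0$). Contained as a subgraph means there is an injective map of vertices sending edges to edges. -}

module Defs where

open import Data.Nat using (ℕ; _<_; _≤_)
open import Data.Fin using (Fin; zero; suc)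
open import Data.List using (List; []; _∷_; _++_; [_]; length)
open import Data.Product using (Σ; _×_; _,_)
open import Data.Sum using (_⊎_)
open import Data.Unit using (⊤)
open import Relation.Binary.PropositionalEquality using (_≡_; _≢_)
open import Function.Definitions using (Injective)

-- Vertices: the three original vertices o₀,o₁,o₂ ("orig i"), and one
-- new vertex "new w" for every bounded face of some S_j (j < d), where
-- a face of S_j is addressed by w : List (Fin 3) of length j: the face
-- of S_0 is [], and the three faces of S_{j+1} into which face w of S_j
-- is split (by the new vertex new w) are w ++ [0], w ++ [1], w ++ [2].

data Vtx : Set where
  orig : Fin 3 → Vtx
  new  : List (Fin 3) → Vtx

Tri : Set
Tri = Vtx × Vtx × Vtx

child : Fin 3 → Vtx → Tri → Tri
child zero             x (a , b , c) = (x , b , c)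
child (suc zero)       x (a , b , c) = (a , x , c)
child (suc (suc zero)) x (a , b , c) = (a , b , x)

-- triFrom p t r : corners of face p ++ r, given that face p has corners t.
triFrom : List (Fin 3) → Tri → List (Fin 3) → Tri
triFrom p t []      = t
triFrom p t (i ∷ r) = triFrom (p ++ [ i ]) (child i (new p) t) r

tri : List (Fin 3) → Tri
tri w = triFrom [] (orig zero , orig (suc zero) , orig (suc (suc zero))) w

InS : ℕ → Vtx → Set
InS d (orig i) = ⊤
InS d (new w)  = length w < d

data Arc (d : ℕ) : Vtx → Vtx → Set where
  base   : (i j : Fin 3) → i ≢ j → Arc d (orig i) (orig j)
  cornerA : ∀ w {a b c} → length w < d → tri w ≡ (a , b , c) → Arc d (new w) a
  cornerB : ∀ w {a b c} → length w < d → tri w ≡ (a , b , c) → Arc d (new w) b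
  cornerC : ∀ w {a b c} → length w < d → tri w ≡ (a , b , c) → Arc d (new w) c

AdjS : ℕ → Vtx → Vtx → Set
AdjS d u v = Arc d u v ⊎ Arc d v u

VS : ℕ → Set
VS d = Σ Vtx (InS d)

TVtx : ℕ → ℕ → Set
TVtx k h = Σ (List (Fin k)) (λ w → length w ≤ h)

data AdjT (k h : ℕ) : TVtx k h → TVtx k h → Set where
  down : ∀ (w : List (Fin k)) (i : Fin k) (p : length w ≤ h)
           (q : length (i ∷ w) ≤ h) → AdjT k h (w , p) (i ∷ w , q)

ContainedIn : (k h d : ℕ) → Set
ContainedIn k h d =
  Σ (TVtx k h → VS d) λ f →
    Injective _≡_ _≡_ f ×
    (∀ u v → AdjT k h u v →
       AdjS d (Data.Product.proj₁ (f u)) (Data.Product.proj₁ (f v)))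

{-# OPTIONS --safe #-}
-- Address the bounded faces of S_d by words over {0,1,2}; face w gets the centre new w.
-- If r avoids the letter j, then new w is still a corner of the face w ++ j ∷ r, hence adjacent
-- to its centre. There are 3 * 2 ^ m such words j ∷ r of length 1 + m, enough to label the k
-- children of a tree vertex once 2 ^ m < k ≤ 2 ^ (1 + m). Concatenating labels along paths from
-- the root places a tree of height h ≥ 1 on centres of faces of depth at most h (1 + m), and
-- 2 ^ (h (1 + m)) < (k * k) ^ h ≤ n * n gives h (1 + m) < ⌈log₂ (n * n)⌉.
-- Height 0 is separate: for n = 1 the depth is 0, and S_0 has no centres at all.
module Submission where

open import Defs
open import Data.Nat using (ℕ; _≤_; _*_; _^_)
open import Data.Nat.Logarithm using (⌈log₂_⌉)

open import Data.Nat using (zero; suc; pred; _+_; _<_; _∸_; z≤n; s≤s; ⌈_/2⌉)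
open import Data.Nat.Properties
open import Data.Nat.Logarithm using (⌈log₂⌉-mono-≤; ⌈log₂⌈n/2⌉⌉≡⌈log₂n⌉∸1)
open import Data.Fin using (Fin; zero; suc; remQuot; combine; inject≤; punchIn)
open import Data.Fin.Properties using (combine-remQuot; inject≤-injective; punchIn-injective; punchInᵢ≢i)
open import Data.List using (List; []; _∷_; _++_; [_]; length; map)
open import Data.List.Properties using (∷-injective; map-injective; length-map; length-++; ++-identityʳ; ++-assoc)
open import Data.List.Relation.Unary.All using (All; []; _∷_; universal)
open import Data.List.Relation.Unary.All.Properties using (map⁺)
open import Data.Product using (_×_; _,_; proj₁; proj₂; ∃-syntax; uncurry)
open import Data.Sum using (inj₂)
open import Data.Empty using (⊥)
open import Function using (_∘_)
open import Algebra.Properties.CommutativeSemigroup *-commutativeSemigroup using (interchange)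
open import Function.Definitions using (Injective)
open import Relation.Nullary using (yes; no; contradiction)
open import Relation.Binary.PropositionalEquality hiding ([_])

corner : Fin 3 → Tri → Vtx
corner zero             = proj₁
corner (suc zero)       = proj₁ ∘ proj₂
corner (suc (suc zero)) = proj₂ ∘ proj₂

corner-child-≡ : ∀ i x t → corner i (child i x t) ≡ x
corner-child-≡ zero             x t = refl
corner-child-≡ (suc zero)       x t = refl
corner-child-≡ (suc (suc zero)) x t = refl

corner-child-≢ : ∀ {i j} x t → i ≢ j → corner j (child i x t) ≡ corner j t
corner-child-≢ {zero}             {zero}             x t i≢j = contradiction refl i≢j
corner-child-≢ {zero}             {suc zero}         x t i≢j = refl
corner-child-≢ {zero}             {suc (suc zero)}   x t i≢j = refl
corner-child-≢ {suc zero}         {zero}             x t i≢j = refl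
corner-child-≢ {suc zero}         {suc zero}         x t i≢j = contradiction refl i≢j
corner-child-≢ {suc zero}         {suc (suc zero)}   x t i≢j = refl
corner-child-≢ {suc (suc zero)}   {zero}             x t i≢j = refl
corner-child-≢ {suc (suc zero)}   {suc zero}         x t i≢j = refl
corner-child-≢ {suc (suc zero)}   {suc (suc zero)}   x t i≢j = contradiction refl i≢j

triFrom-++ : ∀ p t w r → triFrom p t (w ++ r) ≡ triFrom (p ++ w) (triFrom p t w) r
triFrom-++ p t []      r = cong (λ q → triFrom q t r) (sym (++-identityʳ p))
triFrom-++ p t (i ∷ w) r = begin
  triFrom p′ t′ (w ++ r)
    ≡⟨ triFrom-++ p′ t′ w r ⟩
  triFrom (p′ ++ w) (triFrom p′ t′ w) r
    ≡⟨ cong (λ q → triFrom q (triFrom p′ t′ w) r) (++-assoc p [ i ] w) ⟩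
  triFrom (p ++ i ∷ w) (triFrom p′ t′ w) r
    ∎
  where
  open ≡-Reasoning
  p′ = p ++ [ i ]
  t′ = child i (new p) t

corner-triFrom : ∀ {j} p t r → All (_≢ j) r → corner j (triFrom p t r) ≡ corner j t
corner-triFrom p t []      []          = refl
corner-triFrom p t (i ∷ r) (i≢j ∷ r≢j) =
  trans (corner-triFrom (p ++ [ i ]) (child i (new p) t) r r≢j) (corner-child-≢ (new p) t i≢j)

-- Appending j ∷ r to the address w keeps the centre new w as a corner: j makes it corner j,
-- and r never replaces corner j again.
KeepsCentre : List (Fin 3) → Set
KeepsCentre []      = ⊥
KeepsCentre (j ∷ r) = All (_≢ j) r

corner-tri-++ : ∀ w j r → All (_≢ j) r → corner j (tri (w ++ j ∷ r)) ≡ new w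
corner-tri-++ w j r r≢j = begin
  corner j (tri (w ++ j ∷ r))
    ≡⟨ cong (corner j) (triFrom-++ [] _ w (j ∷ r)) ⟩
  corner j (triFrom (w ++ [ j ]) (child j (new w) (tri w)) r)
    ≡⟨ corner-triFrom (w ++ [ j ]) _ r r≢j ⟩
  corner j (child j (new w) (tri w))
    ≡⟨ corner-child-≡ j (new w) (tri w) ⟩
  new w
    ∎
  where open ≡-Reasoning

arc-corner : ∀ {d} w j → length w < d → Arc d (new w) (corner j (tri w))
arc-corner w zero             |w|<d = cornerA w |w|<d refl
arc-corner w (suc zero)       |w|<d = cornerB w |w|<d refl
arc-corner w (suc (suc zero)) |w|<d = cornerC w |w|<d refl

arc-++ : ∀ {d} w s → KeepsCentre s → length (w ++ s) < d → Arc d (new (w ++ s)) (new w)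
arc-++ w (j ∷ r) r≢j |wjr|<d =
  subst (Arc _ (new (w ++ j ∷ r))) (corner-tri-++ w j r r≢j) (arc-corner (w ++ j ∷ r) j |wjr|<d)

remQuot-injective : ∀ {m} n → Injective _≡_ _≡_ (remQuot {m} n)
remQuot-injective {m} n {x} {y} eq = begin
  x                                 ≡⟨ combine-remQuot {m} n x ⟨
  uncurry combine (remQuot {m} n x) ≡⟨ cong (uncurry combine) eq ⟩
  uncurry combine (remQuot {m} n y) ≡⟨ combine-remQuot {m} n y ⟩
  y                                 ∎
  where open ≡-Reasoning

digits : ∀ {b} m → Fin (b ^ m) → List (Fin b)
digits zero    x = []
digits {b} (suc m) x = let d , y = remQuot {b} (b ^ m) x in d ∷ digits m y

length-digits : ∀ {b} m (x : Fin (b ^ m)) → length (digits m x) ≡ m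
length-digits zero    x = refl
length-digits (suc m) x = cong suc (length-digits m _)

digits-injective : ∀ {b} m → Injective _≡_ _≡_ (digits {b} m)
digits-injective zero {zero} {zero} eq = refl
digits-injective {b} (suc m) eq with ∷-injective eq
... | eq₁ , eq₂ = remQuot-injective {b} (b ^ m) (cong₂ _,_ eq₁ (digits-injective m eq₂))

centreKeepingWord : ∀ m → Fin 3 × Fin (2 ^ m) → List (Fin 3)
centreKeepingWord m (j , x) = j ∷ map (punchIn j) (digits m x)

centreKeepingWord-keepsCentre : ∀ m jx → KeepsCentre (centreKeepingWord m jx)
centreKeepingWord-keepsCentre m (j , x) = map⁺ (universal (punchInᵢ≢i j) (digits m x))

length-centreKeepingWord : ∀ m jx → length (centreKeepingWord m jx) ≡ suc m
length-centreKeepingWord m (j , x) =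
  cong suc (trans (length-map (punchIn j) (digits m x)) (length-digits m x))

centreKeepingWord-injective : ∀ m → Injective _≡_ _≡_ (centreKeepingWord m)
centreKeepingWord-injective m {j , x} {j′ , y} eq with ∷-injective eq
... | refl , eq′ = cong (j ,_) (digits-injective m (map-injective (punchIn-injective j _ _) eq′))

++-cancel-≡-length : ∀ {A : Set} (xs xs′ : List A) {ys ys′ : List A} →
  length xs ≡ length xs′ → xs ++ ys ≡ xs′ ++ ys′ → xs ≡ xs′ × ys ≡ ys′
++-cancel-≡-length []       []         _   eq = refl , eq
++-cancel-≡-length (x ∷ xs) (x′ ∷ xs′) len eq with ∷-injective eq
... | refl , eq′ with ++-cancel-≡-length xs xs′ (suc-injective len) eq′
...   | refl , eq″ = refl , eq″

new-injective : ∀ {w w′} → new w ≡ new w′ → w ≡ w′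
new-injective refl = refl

module TreeEmbedding {k m : ℕ} (word : Fin k → List (Fin 3))
  (word-injective : Injective _≡_ _≡_ word)
  (length-word : ∀ c → length (word c) ≡ suc m)
  (word-keepsCentre : ∀ c → KeepsCentre (word c)) where

  address : List (Fin k) → List (Fin 3)
  address []      = []
  address (c ∷ u) = address u ++ word c

  length-address : ∀ u → length (address u) ≡ length u * suc m
  length-address []      = refl
  length-address (c ∷ u) = begin
    length (address u ++ word c)          ≡⟨ length-++ (address u) ⟩
    length (address u) + length (word c)  ≡⟨ cong₂ _+_ (length-address u) (length-word c) ⟩
    length u * suc m + suc m              ≡⟨ +-comm (length u * suc m) (suc m) ⟩
    suc m + length u * suc m              ∎
    where open ≡-Reasoning

  length-address-cong : ∀ u v → length u ≡ length v → length (address u) ≡ length (address v)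
  length-address-cong u v |u|≡|v| =
    trans (length-address u) (trans (cong (_* suc m) |u|≡|v|) (sym (length-address v)))

  address-injective-≡-length : ∀ u v → length u ≡ length v → address u ≡ address v → u ≡ v
  address-injective-≡-length []      []       _   _  = refl
  address-injective-≡-length (c ∷ u) (c′ ∷ v) |cu|≡|c′v| eq =
    let |u|≡|v|   = suc-injective |cu|≡|c′v|
        eq₁ , eq₂ = ++-cancel-≡-length (address u) (address v) (length-address-cong u v |u|≡|v|) eq
    in cong₂ _∷_ (word-injective eq₂) (address-injective-≡-length u v |u|≡|v| eq₁)

  address-injective : Injective _≡_ _≡_ address
  address-injective {u} {v} eq = address-injective-≡-length u v |u|≡|v| eq
    where
    |u|≡|v| : length u ≡ length v
    |u|≡|v| = *-cancelʳ-≡ (length u) (length v) (suc m)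
      (trans (sym (length-address u)) (trans (cong length eq) (length-address v)))

  contained : ∀ {h d} → h * suc m < d → ContainedIn k h d
  contained {h} {d} h*[1+m]<d = embed , embed-injective , embed-adjacent
    where
    address-fits : ∀ u → length u ≤ h → length (address u) < d
    address-fits u |u|≤h = begin-strict
      length (address u)  ≡⟨ length-address u ⟩
      length u * suc m    ≤⟨ *-monoˡ-≤ (suc m) |u|≤h ⟩
      h * suc m           <⟨ h*[1+m]<d ⟩
      d                   ∎
      where open ≤-Reasoning

    embed : TVtx k h → VS d
    embed (u , |u|≤h) = new (address u) , address-fits u |u|≤h

    embed-injective : Injective _≡_ _≡_ embed
    embed-injective {u , p} {v , q} eq with address-injective {u} {v} (new-injective (cong proj₁ eq))
    ... | refl = cong (u ,_) (≤-irrelevant p q)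

    embed-adjacent : ∀ u v → AdjT k h u v → AdjS d (proj₁ (embed u)) (proj₁ (embed v))
    embed-adjacent _ _ (down w c _ |cw|≤h) =
      inj₂ (arc-++ (address w) (word c) (word-keepsCentre c) (address-fits (c ∷ w) |cw|≤h))

childWord : ∀ {k} m → k ≤ 3 * 2 ^ m → Fin k → List (Fin 3)
childWord m k≤3*2^m c = centreKeepingWord m (remQuot (2 ^ m) (inject≤ c k≤3*2^m))

contained-by-childWords : ∀ {k h d} m → k ≤ 3 * 2 ^ m → h * suc m < d → ContainedIn k h d
contained-by-childWords m k≤3*2^m = contained
  where
  open TreeEmbedding (childWord m k≤3*2^m)
    (λ {c} {c′} eq → inject≤-injective k≤3*2^m k≤3*2^m c c′
      (remQuot-injective {3} (2 ^ m) (centreKeepingWord-injective m eq)))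
    (λ _ → length-centreKeepingWord m _)
    (λ _ → centreKeepingWord-keepsCentre m _)

single-vertex-contained : ∀ k d → ContainedIn k 0 d
single-vertex-contained k d =
  (λ _ → orig zero , _) , (λ {u} {v} _ → root-unique u v) , λ { _ _ (down _ _ _ ()) }
  where
  root-unique : (u v : TVtx k 0) → u ≡ v
  root-unique ([] , z≤n) ([] , z≤n) = refl

pow₂-bracket : ∀ k → 2 ≤ k → ∃[ m ] 2 ^ m < k × k ≤ 2 ^ suc m
pow₂-bracket 1 (s≤s ())
pow₂-bracket 2 _ = 0 , ≤-refl , ≤-refl
pow₂-bracket (suc k@(suc (suc _))) _ with pow₂-bracket k (s≤s (s≤s z≤n))
... | m , 2^m<k , k≤2^[1+m] with suc k ≤? 2 ^ suc m
...   | yes 1+k≤2^[1+m] = m , m<n⇒m<1+n 2^m<k , 1+k≤2^[1+m]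
...   | no  1+k≰2^[1+m] = suc m , ≰⇒> 1+k≰2^[1+m] , (begin
        suc k      ≤⟨ s≤s k≤2^[1+m] ⟩
        1 + P      ≤⟨ +-monoˡ-≤ P (m^n>0 2 (suc m)) ⟩
        P + P      ≡⟨ cong (P +_) (+-identityʳ P) ⟨
        2 * P      ∎)
  where
  P = 2 ^ suc m
  open ≤-Reasoning

2*m<n⇒m<⌈n/2⌉ : ∀ m {n} → 2 * m < n → m < ⌈ n /2⌉
2*m<n⇒m<⌈n/2⌉ m {n} 2*m<n = begin
  suc m              ≡⟨ cong suc (n≡⌊n+n/2⌋ m) ⟩
  ⌈ suc (m + m) /2⌉  ≤⟨ ⌈n/2⌉-mono (subst (_< n) (cong (m +_) (+-identityʳ m)) 2*m<n) ⟩
  ⌈ n /2⌉            ∎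
  where open ≤-Reasoning

2^m<n⇒m<⌈log₂n⌉ : ∀ m {n} → 2 ^ m < n → m < ⌈log₂ n ⌉
2^m<n⇒m<⌈log₂n⌉ zero    {n} 1<n = ⌈log₂⌉-mono-≤ {2 ^ 1} {n} 1<n
2^m<n⇒m<⌈log₂n⌉ (suc m) {n} 2^[1+m]<n = pred-cancel-< (begin-strict
  m                 <⟨ 2^m<n⇒m<⌈log₂n⌉ m (2*m<n⇒m<⌈n/2⌉ (2 ^ m) 2^[1+m]<n) ⟩
  ⌈log₂ ⌈ n /2⌉ ⌉   ≡⟨ ⌈log₂⌈n/2⌉⌉≡⌈log₂n⌉∸1 n ⟩
  ⌈log₂ n ⌉ ∸ 1     ≡⟨ pred[m∸n]≡m∸[1+n] ⌈log₂ n ⌉ 0 ⟨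
  pred ⌈log₂ n ⌉    ∎)
  where open ≤-Reasoning

^-distribʳ-* : ∀ m n o → (m * n) ^ o ≡ m ^ o * n ^ o
^-distribʳ-* m n zero    = refl
^-distribʳ-* m n (suc o) =
  trans (cong (m * n *_) (^-distribʳ-* m n o)) (interchange m n (m ^ o) (n ^ o))

depth-bound : ∀ {k n m} h → 2 ^ m < k → k ^ suc h ≤ n → suc h * suc m < ⌈log₂ (n * n) ⌉
depth-bound {k} {n} {m} h 2^m<k k^[1+h]≤n = 2^m<n⇒m<⌈log₂n⌉ (suc h * suc m) (begin-strict
  2 ^ (suc h * suc m)      ≡⟨ cong (2 ^_) (*-comm (suc h) (suc m)) ⟩
  2 ^ (suc m * suc h)      ≡⟨ ^-*-assoc 2 (suc m) (suc h) ⟨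
  (2 * 2 ^ m) ^ suc h      <⟨ ^-monoˡ-< (suc h) 2^[1+m]<k*k ⟩
  (k * k) ^ suc h          ≡⟨ ^-distribʳ-* k k (suc h) ⟩
  k ^ suc h * k ^ suc h    ≤⟨ *-mono-≤ k^[1+h]≤n k^[1+h]≤n ⟩
  n * n                    ∎)
  where
  open ≤-Reasoning
  2^[1+m]<k*k : 2 * 2 ^ m < k * k
  2^[1+m]<k*k = <-≤-trans (*-monoʳ-< 2 2^m<k) (*-monoˡ-≤ k (≤-trans (s≤s (m^n>0 2 m)) 2^m<k))

proposition3 : (k n : ℕ) → 2 ≤ k → 1 ≤ n →
    (h : ℕ) → k ^ h ≤ n →
    ContainedIn k h ⌈log₂ (n * n) ⌉
proposition3 k _ _   _ zero    _         = single-vertex-contained k _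
proposition3 k n 2≤k _ (suc h) k^[1+h]≤n with pow₂-bracket k 2≤k
... | m , 2^m<k , k≤2^[1+m] =
  contained-by-childWords m (≤-trans k≤2^[1+m] (*-monoˡ-≤ (2 ^ m) (n≤1+n 2)))
    (depth-bound h 2^m<k k^[1+h]≤n)
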